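{- For every integer $m\ge 2$, there is a graph $G$ that has a $2$-local $m$-cover and satisfies $\mathrm{lbp}(G)\ge \frac{1}{2}\log\left(\frac{m-1}{3}\right)$.
   Context: $\log$ denotes $\log_2$. A biclique of a graph $G$ is a complete bipartite subgraph of $G$. A biclique cover of $G$ is a collection of bicliques of $G$ whose edge sets have union $E(G)$; a biclique partition is a collection of bicliques whose edge sets partition $E(G)$. A cover (or partition) is an $m$-cover (resp. $m$-partition) if it contains at most $m$ bicliques, and it is $r$-local if every vertex of $G$ lies in at most $r$ of its bicliques. $\mathrm{lbp}(G)$ is the least $r$ such that $G$ has an $r$-local biclique partition. -}

module Defs where

open import Data.Nat using (ℕ; zero; suc; _+_; _*_; _^_; _≤_; _∸_)
open import Data.Fin using (Fin)
open import Data.Bool using (Bool; true; false; _∨_; _∧_; if_then_else_)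
open import Data.List using (List; []; _∷_; length)
open import Data.Product using (Σ; ∃; _×_; _,_)
open import Relation.Binary.PropositionalEquality using (_≡_)

record Graph : Set where
  field
    n     : ℕ
    adj   : Fin n → Fin n → Bool
    sym   : ∀ u v → adj u v ≡ adj v u
    irrefl : ∀ v → adj v v ≡ false
open Graph public

record Biclique (G : Graph) : Set where
  field
    A : Fin (n G) → Bool
    B : Fin (n G) → Bool
    A-nonempty : ∃ λ a → A a ≡ true
    B-nonempty : ∃ λ b → B b ≡ true
    disjoint : ∀ v → A v ∧ B v ≡ false
    complete : ∀ a b → A a ≡ true → B b ≡ true → adj G a b ≡ true
open Biclique public

hasVertex : {G : Graph} → Biclique G → Fin (n G) → Bool
hasVertex K v = A K v ∨ B K v

hasEdge : {G : Graph} → Biclique G → Fin (n G) → Fin (n G) → Bool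
hasEdge K u v = (A K u ∧ B K v) ∨ (A K v ∧ B K u)

count : {X : Set} → (X → Bool) → List X → ℕ
count p [] = 0
count p (x ∷ xs) = (if p x then 1 else 0) + count p xs

IsCover : (G : Graph) → List (Biclique G) → Set
IsCover G Ks = ∀ u v → adj G u v ≡ true → 1 ≤ count (λ K → hasEdge K u v) Ks

-- A biclique partition: every edge of G lies in exactly one biclique of
-- the collection (counted with multiplicity).
IsPartition : (G : Graph) → List (Biclique G) → Set
IsPartition G Ks = ∀ u v → adj G u v ≡ true → count (λ K → hasEdge K u v) Ks ≡ 1

IsLocal : (G : Graph) → ℕ → List (Biclique G) → Set
IsLocal G r Ks = ∀ v → count (λ K → hasVertex K v) Ks ≤ r

HasLocalMCover : ℕ → ℕ → Graph → Set
HasLocalMCover r m G = Σ (List (Biclique G)) λ Ks → IsCover G Ks × length Ks ≤ m × IsLocal G r Ks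

HasLocalPartition : ℕ → Graph → Set
HasLocalPartition r G = Σ (List (Biclique G)) λ Ks → IsPartition G Ks × IsLocal G r Ks

-- lbp(G) ≥ (1/2) log((m-1)/3): every r-local partition has r ≥ (1/2)log((m-1)/3),
-- which for natural r is equivalent to m - 1 ≤ 3 * 4^r.
LbpAtLeastHalfLog : Graph → ℕ → Set
LbpAtLeastHalfLog G m = ∀ r → HasLocalPartition r G → m ∸ 1 ≤ 3 * 4 ^ r

-- G is the line graph of the complete digraph on m vertices: its vertices are the arcs a → b, two arcs
-- being adjacent when one ends where the other starts. The m stars (arcs into c, arcs out of c) form a
-- 2-local cover. Now take an r-local biclique partition. The block of the 2-cycle i ⇄ c cannot contain
-- both a second arc into c and a second arc into i, so every 2-cycle is private to one of its ends,
-- and some c has at least (m - 1)/2 private partners i. For these the pairs (i → c, c → i) form a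
-- fooling set: recording, for each biclique, the side containing the pair gives partial words with at
-- most 2r letters, and the words of i and j conflict at the block of the edge (j → c, c → i). By
-- Kraft's inequality there are at most 2^(2r) such words, hence m - 1 ≤ 2 · 4^r.

module Submission where

open import Defs hiding (sym)
open import Level using (Level)
open import Data.Nat using (ℕ; zero; suc; _+_; _*_; _^_; _≤_; _∸_; z≤n; s≤s)
open import Data.Nat.Properties
open import Data.Nat.Tactic.RingSolver using (solve-∀)
open import Data.Bool using (Bool; true; false; T; _∧_; _∨_; if_then_else_)
open import Data.Bool.Properties using (∨-comm; ∨-zeroʳ; ∧-identityʳ; ¬-not; T-≡) renaming (_≟_ to _≟ᵇ_)
open import Data.Maybe using (Maybe; just; nothing)
open import Data.Fin using (Fin; zero; suc; punchIn; combine; remQuot) renaming (_≟_ to _≟ᶠ_)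
open import Data.Fin.Properties using (punchInᵢ≢i; remQuot-combine; combine-remQuot)
import Data.Fin.Properties as Finₚ
open import Data.Vec as Vec using (Vec; []; _∷_; head; tail; fromList)
open import Data.List using (List; []; _∷_; tabulate; length)
open import Data.List.Properties using (length-tabulate)
open import Data.List.Membership.Propositional using (_∈_)
open import Data.List.Membership.Propositional.Properties using (∈-tabulate⁺)
open import Data.List.Relation.Unary.Any using (here; there)
open import Data.List.Relation.Unary.All as All using (All)
open import Data.Product using (Σ; ∃; _×_; _,_; proj₁; proj₂)
open import Data.Sum as Sum using (_⊎_; inj₁; inj₂; swap)
open import Function using (_∘_; mk⇔; Equivalence)
open import Relation.Unary using (Pred)
open import Relation.Binary using (Rel)
open import Relation.Binary.PropositionalEquality
open import Relation.Nullary using (¬_; Dec; yes; no; does; ¬?; _×-dec_; _⊎-dec_; _→-dec_; contradiction)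
open import Relation.Nullary.Decidable using (T?; dec-true; dec-false; does-⇔; decidable-stable)
open import Algebra.Properties.Semiring.Sum +-*-semiring
  using (sum; sum-syntax; sum-cong-≗; sum-remove; ∑-distrib-+; ∑-comm; *-distribˡ-sum; *-distribʳ-sum)

private variable
  ℓ : Level
  X Y : Set ℓ
  k L d : ℕ

𝟙 : Dec X → ℕ
𝟙 x? = if does x? then 1 else 0

does≡true⇒ : (x? : Dec X) → does x? ≡ true → X
does≡true⇒ (yes x) _ = x

𝟙-⊎ : (x? : Dec X) (y? : Dec Y) {Z : Set ℓ} (z? : Dec Z) → (X → Y ⊎ Z) → 𝟙 x? ≤ 𝟙 y? + 𝟙 z?
𝟙-⊎ (no _)  _       _       _ = z≤n
𝟙-⊎ (yes x) y? z? split with split x | y? | z?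
... | _      | yes _ | _     = s≤s z≤n
... | _      | no _  | yes _ = s≤s z≤n
... | inj₁ y | no ¬y | no _  = contradiction y ¬y
... | inj₂ z | no _  | no ¬z = contradiction z ¬z

sum-mono-≤ : (f g : Fin k → ℕ) → (∀ i → f i ≤ g i) → sum f ≤ sum g
sum-mono-≤ {zero}  f g f≤g = z≤n
sum-mono-≤ {suc k} f g f≤g = +-mono-≤ (f≤g zero) (sum-mono-≤ (f ∘ suc) (g ∘ suc) (f≤g ∘ suc))

sum≤k*a : ∀ (f : Fin k → ℕ) a → (∀ i → f i ≤ a) → sum f ≤ k * a
sum≤k*a {zero}  f a f≤a = z≤n
sum≤k*a {suc k} f a f≤a = +-mono-≤ (f≤a zero) (sum≤k*a (f ∘ suc) a (f≤a ∘ suc))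

k*a≤sum : ∀ (f : Fin k → ℕ) a → (∀ i → a ≤ f i) → k * a ≤ sum f
k*a≤sum {zero}  f a a≤f = z≤n
k*a≤sum {suc k} f a a≤f = +-mono-≤ (a≤f zero) (k*a≤sum (f ∘ suc) a (a≤f ∘ suc))

k∸1≤sum : ∀ (f : Fin k → ℕ) (c : Fin k) → (∀ i → i ≢ c → 1 ≤ f i) → k ∸ 1 ≤ sum f
k∸1≤sum {suc k} f c pos = begin
  k                                   ≡⟨ *-identityʳ k ⟨
  k * 1                               ≤⟨ k*a≤sum (f ∘ punchIn c) 1 (λ j → pos (punchIn c j) (punchInᵢ≢i c j)) ⟩
  ∑[ j < k ] f (punchIn c j)          ≤⟨ m≤n+m _ (f c) ⟩
  f c + ∑[ j < k ] f (punchIn c j)    ≡⟨ sum-remove {i = c} f ⟨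
  sum f                               ∎
  where open ≤-Reasoning

sum-𝟙≤1 : {P : Pred (Fin k) ℓ} (P? : ∀ i → Dec (P i)) →
  (∀ i j → P i → P j → i ≡ j) → ∑[ i < k ] 𝟙 (P? i) ≤ 1
sum-𝟙≤1 {zero}  P? unique = z≤n
sum-𝟙≤1 {suc k} P? unique with P? zero
... | yes p₀ = +-monoʳ-≤ 1 (≤-trans (sum≤k*a _ 0 absent) (≤-reflexive (*-zeroʳ k)))
  where
  absent : ∀ i → 𝟙 (P? (suc i)) ≤ 0
  absent i with P? (suc i)
  ... | yes p = contradiction (unique _ _ p₀ p) λ ()
  ... | no _  = z≤n
... | no _ = sum-𝟙≤1 (P? ∘ suc) λ i j p q → Finₚ.suc-injective (unique _ _ p q)

-- Partial Boolean words

Word : ℕ → Set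
Word = Vec (Maybe Bool)

data Conflict : Word L → Word L → Set where
  here  : ∀ {a b} {s t : Word L} → a ≢ b → Conflict (just a ∷ s) (just b ∷ t)
  there : ∀ {x y} {s t : Word L} → Conflict s t → Conflict (x ∷ s) (y ∷ t)

freeWeight : Word L → ℕ
freeWeight []            = 1
freeWeight (nothing ∷ s) = 2 * freeWeight s
freeWeight (just _ ∷ s)  = freeWeight s

defined : Word L → ℕ
defined []            = 0
defined (nothing ∷ s) = defined s
defined (just _ ∷ s)  = suc (defined s)

2^defined*freeWeight≡2^length : (s : Word L) → 2 ^ defined s * freeWeight s ≡ 2 ^ L
2^defined*freeWeight≡2^length []            = refl
2^defined*freeWeight≡2^length (just _ ∷ s)  =
  trans (*-assoc 2 (2 ^ defined s) (freeWeight s)) (cong (2 *_) (2^defined*freeWeight≡2^length s))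
2^defined*freeWeight≡2^length (nothing ∷ s) = begin
  2 ^ defined s * (2 * freeWeight s)  ≡⟨ *-comm (2 ^ defined s) _ ⟩
  2 * freeWeight s * 2 ^ defined s    ≡⟨ *-assoc 2 (freeWeight s) _ ⟩
  2 * (freeWeight s * 2 ^ defined s)  ≡⟨ cong (2 *_) (*-comm (freeWeight s) _) ⟩
  2 * (2 ^ defined s * freeWeight s)  ≡⟨ cong (2 *_) (2^defined*freeWeight≡2^length s) ⟩
  2 * 2 ^ Vec.length s                ∎
  where open ≡-Reasoning

data Admits (b : Bool) : Maybe Bool → Set where
  unset : Admits b nothing
  set   : Admits b (just b)

admits? : ∀ b x → Dec (Admits b x)
admits? _     nothing      = yes unset
admits? false (just false) = yes set
admits? true  (just true)  = yes set
admits? false (just true)  = no λ ()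
admits? true  (just false) = no λ ()

no-Conflict-[] : {s t : Word 0} → ¬ Conflict s t
no-Conflict-[] {[]} {[]} ()

Conflict-tail : ∀ {b} (s t : Word (suc L)) → Admits b (head s) → Admits b (head t) →
  Conflict s t → Conflict (tail s) (tail t)
Conflict-tail _ _ set set (here a≢a) = contradiction refl a≢a
Conflict-tail _ _ _   _   (there c)  = c

weight-split : (p? : Dec X) (s : Word (suc L)) →
  𝟙 p? * freeWeight s ≡ 𝟙 (p? ×-dec admits? false (head s)) * freeWeight (tail s)
                      + 𝟙 (p? ×-dec admits? true  (head s)) * freeWeight (tail s)
weight-split (no _)  (_ ∷ _)            = refl
weight-split (yes _) (just true ∷ _)    = refl
weight-split (yes _) (just false ∷ s)   = sym (+-identityʳ _)
weight-split (yes _) (nothing ∷ s)      = doubling (freeWeight s)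
  where
  doubling : ∀ w → 1 * (2 * w) ≡ 1 * w + 1 * w
  doubling = solve-∀

PairwiseConflicting : (P : Pred (Fin k) ℓ) → (Fin k → Word L) → Set ℓ
PairwiseConflicting P s = ∀ i j → i ≢ j → P i → P j → Conflict (s i) (s j)

-- The sets of completions of pairwise conflicting words are disjoint.
kraft : {P : Pred (Fin k) ℓ} (P? : ∀ i → Dec (P i)) (s : Fin k → Word L) →
  PairwiseConflicting P s → ∑[ i < k ] (𝟙 (P? i) * freeWeight (s i)) ≤ 2 ^ L
kraft {k = k} {L = zero} {P = P} P? s conflicting = begin
  ∑[ i < k ] (𝟙 (P? i) * freeWeight (s i))  ≡⟨ sum-cong-≗ (λ i → weight-empty (P? i) (s i)) ⟩
  ∑[ i < k ] 𝟙 (P? i)                       ≤⟨ sum-𝟙≤1 P? unique ⟩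
  1                                         ∎
  where
  open ≤-Reasoning
  weight-empty : (p? : Dec X) (t : Word 0) → 𝟙 p? * freeWeight t ≡ 𝟙 p?
  weight-empty p? [] = *-identityʳ (𝟙 p?)
  unique : ∀ i j → P i → P j → i ≡ j
  unique i j p q = decidable-stable (i ≟ᶠ j) λ i≢j → no-Conflict-[] (conflicting i j i≢j p q)
kraft {k = k} {L = suc L} {P = P} P? s conflicting = begin
  ∑[ i < k ] (𝟙 (P? i) * freeWeight (s i))                 ≡⟨ sum-cong-≗ (λ i → weight-split (P? i) (s i)) ⟩
  ∑[ i < k ] (restricted false i + restricted true i)     ≡⟨ ∑-distrib-+ (restricted false) (restricted true) ⟩
  ∑[ i < k ] restricted false i + ∑[ i < k ] restricted true i
    ≤⟨ +-mono-≤ (kraft (P′? false) (tail ∘ s) (conflicting′ false))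
                (kraft (P′? true) (tail ∘ s) (conflicting′ true)) ⟩
  2 ^ L + 2 ^ L                                           ≡⟨ cong (2 ^ L +_) (+-identityʳ (2 ^ L)) ⟨
  2 ^ suc L                                               ∎
  where
  open ≤-Reasoning
  P′? : ∀ b i → Dec (P i × Admits b (head (s i)))
  P′? b i = P? i ×-dec admits? b (head (s i))
  restricted : Bool → Fin k → ℕ
  restricted b i = 𝟙 (P′? b i) * freeWeight (tail (s i))
  conflicting′ : ∀ b → PairwiseConflicting (λ i → P i × Admits b (head (s i))) (tail ∘ s)
  conflicting′ b i j i≢j (p , a) (q , a′) = Conflict-tail (s i) (s j) a a′ (conflicting i j i≢j p q)

conflicting-words≤2^d : {P : Pred (Fin k) ℓ} (P? : ∀ i → Dec (P i)) (s : Fin k → Word L) →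
  PairwiseConflicting P s → (∀ i → P i → defined (s i) ≤ d) → ∑[ i < k ] 𝟙 (P? i) ≤ 2 ^ d
conflicting-words≤2^d {k = k} {L = L} {d = d} P? s conflicting sparse =
  *-cancelʳ-≤ _ _ (2 ^ L) {{m^n≢0 2 L}} (begin
    (∑[ i < k ] 𝟙 (P? i)) * 2 ^ L                      ≡⟨ *-distribʳ-sum (2 ^ L) (𝟙 ∘ P?) ⟩
    ∑[ i < k ] (𝟙 (P? i) * 2 ^ L)                      ≤⟨ sum-mono-≤ _ _ termwise ⟩
    ∑[ i < k ] (2 ^ d * (𝟙 (P? i) * freeWeight (s i)))  ≡⟨ *-distribˡ-sum (2 ^ d) (λ i → 𝟙 (P? i) * freeWeight (s i)) ⟨
    2 ^ d * ∑[ i < k ] (𝟙 (P? i) * freeWeight (s i))    ≤⟨ *-monoʳ-≤ (2 ^ d) (kraft P? s conflicting) ⟩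
    2 ^ d * 2 ^ L                                      ∎)
  where
  open ≤-Reasoning
  termwise : ∀ i → 𝟙 (P? i) * 2 ^ L ≤ 2 ^ d * (𝟙 (P? i) * freeWeight (s i))
  termwise i with P? i
  ... | no _  = z≤n
  ... | yes p = begin
    1 * 2 ^ L                             ≡⟨ *-identityˡ (2 ^ L) ⟩
    2 ^ L                                 ≡⟨ 2^defined*freeWeight≡2^length (s i) ⟨
    2 ^ defined (s i) * freeWeight (s i)  ≤⟨ *-monoˡ-≤ (freeWeight (s i)) (^-monoʳ-≤ 2 (sparse i p)) ⟩
    2 ^ d * freeWeight (s i)              ≡⟨ cong (2 ^ d *_) (*-identityˡ (freeWeight (s i))) ⟨
    2 ^ d * (1 * freeWeight (s i))        ∎

semicomplete-order∸1≤2*outdegree : {R : Rel (Fin k) ℓ} (R? : ∀ c i → Dec (R c i)) →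
  (∀ c i → i ≢ c → R c i ⊎ R i c) → (∀ c → ∑[ i < k ] 𝟙 (R? c i) ≤ d) → k ∸ 1 ≤ 2 * d
semicomplete-order∸1≤2*outdegree {k = zero} R? semicomplete outdegree = z≤n
semicomplete-order∸1≤2*outdegree {k = suc k} {d = d} R? semicomplete outdegree =
  *-cancelˡ-≤ (suc k) (begin
    suc k * k                                            ≤⟨ k*a≤sum _ k (λ c → k∸1≤sum (joined c) c (λ i → covered c i)) ⟩
    ∑[ c < suc k ] ∑[ i < suc k ] (out c i + out i c)    ≡⟨ sum-cong-≗ (λ c → ∑-distrib-+ (out c) (λ i → out i c)) ⟩
    ∑[ c < suc k ] (∑[ i < suc k ] out c i + ∑[ i < suc k ] out i c)
                                                         ≡⟨ ∑-distrib-+ (λ c → ∑[ i < suc k ] out c i) (λ c → ∑[ i < suc k ] out i c) ⟩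
    S + ∑[ c < suc k ] ∑[ i < suc k ] out i c            ≡⟨ cong (S +_) (∑-comm (λ c i → out i c)) ⟩
    S + S                                                ≤⟨ +-mono-≤ bound bound ⟩
    suc k * d + suc k * d                                ≡⟨ *-distribˡ-+ (suc k) d d ⟨
    suc k * (d + d)                                      ≡⟨ cong (λ x → suc k * (d + x)) (+-identityʳ d) ⟨
    suc k * (2 * d)                                      ∎)
  where
  open ≤-Reasoning
  out : Fin (suc k) → Fin (suc k) → ℕ
  out c i = 𝟙 (R? c i)
  joined : Fin (suc k) → Fin (suc k) → ℕ
  joined c i = out c i + out i c
  S : ℕ
  S = ∑[ c < suc k ] ∑[ i < suc k ] out c i
  bound : S ≤ suc k * d
  bound = sum≤k*a _ d outdegree
  covered : ∀ c i → i ≢ c → 1 ≤ joined c i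
  covered c i i≢c with semicomplete c i i≢c | R? c i | R? i c
  ... | inj₁ r | no ¬r | _     = contradiction r ¬r
  ... | inj₂ r | _     | no ¬r = contradiction r ¬r
  ... | _      | yes _ | _     = s≤s z≤n
  ... | _      | no _  | yes _ = s≤s z≤n

-- Biclique covers and partitions

module _ {X : Set} (P : X → Bool) where

  count≥1⇒∈ : ∀ xs → 1 ≤ count P xs → ∃ λ x → x ∈ xs × P x ≡ true
  count≥1⇒∈ (x ∷ xs) pos with P x in Px
  ... | true  = x , here refl , Px
  ... | false = let y , y∈xs , Py = count≥1⇒∈ xs pos in y , there y∈xs , Py

  ∈⇒count≥1 : ∀ {x xs} → x ∈ xs → P x ≡ true → 1 ≤ count P xs
  ∈⇒count≥1 {xs = y ∷ xs} (here refl) Px rewrite Px = s≤s z≤n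
  ∈⇒count≥1 {xs = y ∷ xs} (there x∈xs) Px = ≤-trans (∈⇒count≥1 x∈xs Px) (m≤n+m _ _)

  count≡0⇒∉ : ∀ {x xs} → count P xs ≡ 0 → x ∈ xs → P x ≢ true
  count≡0⇒∉ none x∈xs Px = contradiction (subst (1 ≤_) none (∈⇒count≥1 x∈xs Px)) λ ()

  count≡1⇒unique : ∀ {x y xs} → count P xs ≡ 1 → x ∈ xs → y ∈ xs → P x ≡ true → P y ≡ true → x ≡ y
  count≡1⇒unique {xs = z ∷ xs} once (here refl) (here refl) _ _ = refl
  count≡1⇒unique {xs = z ∷ xs} once (here refl) (there y∈xs) Px Py rewrite Px =
    contradiction Py (count≡0⇒∉ (suc-injective once) y∈xs)
  count≡1⇒unique {xs = z ∷ xs} once (there x∈xs) (here refl) Px Py rewrite Py =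
    contradiction Px (count≡0⇒∉ (suc-injective once) x∈xs)
  count≡1⇒unique {xs = z ∷ xs} once (there x∈xs) (there y∈xs) Px Py with P z
  ... | true  = contradiction Px (count≡0⇒∉ (suc-injective once) x∈xs)
  ... | false = count≡1⇒unique once x∈xs y∈xs Px Py

  count-tabulate : ∀ {k} (f : Fin k → X) → count P (tabulate f) ≡ ∑[ i < k ] 𝟙 (T? (P (f i)))
  count-tabulate {zero}  f = refl
  count-tabulate {suc k} f = cong (𝟙 (T? (P (f zero))) +_) (count-tabulate (f ∘ suc))

module _ {G : Graph} (K : Biclique G) where

  private
    ∨-∧-elim : ∀ {a b c d} → (a ∧ b) ∨ (c ∧ d) ≡ true → (a ≡ true × b ≡ true) ⊎ (c ≡ true × d ≡ true)
    ∨-∧-elim {true}  {true}                 _ = inj₁ (refl , refl)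
    ∨-∧-elim {true}  {false} {true} {true}  _ = inj₂ (refl , refl)
    ∨-∧-elim {false} {_}     {true} {true}  _ = inj₂ (refl , refl)

    ∨-∧-intro : ∀ {a b c d} → a ∨ b ≡ true → c ∨ d ≡ true → a ≢ c → (a ∧ d) ∨ (c ∧ b) ≡ true
    ∨-∧-intro {true}  {_}    {true}         _ _ a≢c = contradiction refl a≢c
    ∨-∧-intro {true}  {_}    {false} {true} _ _ _   = refl
    ∨-∧-intro {false} {true} {true}         _ _ _   = refl
    ∨-∧-intro {false} {_}    {false}        _ _ a≢c = contradiction refl a≢c

  edge⇒sides : ∀ {u v} → hasEdge K u v ≡ true →
    (A K u ≡ true × B K v ≡ true) ⊎ (A K v ≡ true × B K u ≡ true)
  edge⇒sides = ∨-∧-elim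

  A⇒vertex : ∀ {v} → A K v ≡ true → hasVertex K v ≡ true
  A⇒vertex {v} Av = cong (_∨ B K v) Av

  B⇒vertex : ∀ {v} → B K v ≡ true → hasVertex K v ≡ true
  B⇒vertex {v} Bv = trans (cong (A K v ∨_) Bv) (∨-zeroʳ (A K v))

  B⇒¬A : ∀ {v} → B K v ≡ true → A K v ≡ false
  B⇒¬A {v} Bv = trans (sym (∧-identityʳ (A K v))) (trans (cong (A K v ∧_) (sym Bv)) (disjoint K v))

  edge⇒vertexˡ : ∀ {u v} → hasEdge K u v ≡ true → hasVertex K u ≡ true
  edge⇒vertexˡ e with edge⇒sides e
  ... | inj₁ (Au , _) = A⇒vertex Au
  ... | inj₂ (_ , Bu) = B⇒vertex Bu

  edge⇒vertexʳ : ∀ {u v} → hasEdge K u v ≡ true → hasVertex K v ≡ true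
  edge⇒vertexʳ e with edge⇒sides e
  ... | inj₁ (_ , Bv) = B⇒vertex Bv
  ... | inj₂ (Av , _) = A⇒vertex Av

  edge⇒sides≢ : ∀ {u v} → hasEdge K u v ≡ true → A K u ≢ A K v
  edge⇒sides≢ e with edge⇒sides e
  ... | inj₁ (Au , Bv) = λ Au≡Av → contradiction (trans (sym Au) (trans Au≡Av (B⇒¬A Bv))) λ ()
  ... | inj₂ (Av , Bu) = λ Au≡Av → contradiction (trans (sym (B⇒¬A Bu)) (trans Au≡Av Av)) λ ()

  edge⇒adj : ∀ {u v} → hasEdge K u v ≡ true → adj G u v ≡ true
  edge⇒adj {u} {v} e with edge⇒sides e
  ... | inj₁ (Au , Bv) = complete K u v Au Bv
  ... | inj₂ (Av , Bu) = trans (Graph.sym G u v) (complete K v u Av Bu)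

  sides≢⇒edge : ∀ {u v} → hasVertex K u ≡ true → hasVertex K v ≡ true → A K u ≢ A K v → hasEdge K u v ≡ true
  sides≢⇒edge = ∨-∧-intro

  sides≢⇒adj : ∀ {u v} → hasVertex K u ≡ true → hasVertex K v ≡ true → A K u ≢ A K v → adj G u v ≡ true
  sides≢⇒adj hu hv = edge⇒adj ∘ sides≢⇒edge hu hv

  nonadjacent⇒sameSide : ∀ {u v} → hasVertex K u ≡ true → hasVertex K v ≡ true →
    adj G u v ≢ true → A K u ≡ A K v
  nonadjacent⇒sameSide {u} {v} hu hv ¬adj = decidable-stable (A K u ≟ᵇ A K v) (¬adj ∘ sides≢⇒adj hu hv)

  hasEdge-sym : ∀ u v → hasEdge K u v ≡ hasEdge K v u
  hasEdge-sym u v = ∨-comm (A K u ∧ B K v) (A K v ∧ B K u)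

module _ {G : Graph} where

  label : Fin (n G) → Fin (n G) → Biclique G → Maybe Bool
  label p q K = if hasVertex K p then just (A K p) else if hasVertex K q then just (A K q) else nothing

  signature : (Ks : List (Biclique G)) → Fin (n G) → Fin (n G) → Word (length Ks)
  signature Ks p q = Vec.map (label p q) (fromList Ks)

  label-vertex : ∀ K p q → hasVertex K p ≡ true → label p q K ≡ just (A K p)
  label-vertex K p q hp rewrite hp = refl

  label-nonEdge : ∀ K p q → hasVertex K q ≡ true → hasEdge K p q ≡ false → label p q K ≡ just (A K q)
  label-nonEdge K p q hq ¬e with hasVertex K p in hp
  ... | false rewrite hq = refl
  ... | true  = cong just (decidable-stable (A K p ≟ᵇ A K q) λ A≢ → true≢false (trans (sym (sides≢⇒edge K hp hq A≢)) ¬e))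
    where
    true≢false : true ≢ false
    true≢false ()

  defined-signature : ∀ Ks p q →
    defined (signature Ks p q) ≤ count (λ K → hasVertex K p) Ks + count (λ K → hasVertex K q) Ks
  defined-signature []       p q = z≤n
  defined-signature (K ∷ Ks) p q with hasVertex K p | hasVertex K q
  ... | true  | inq   = s≤s (≤-trans (defined-signature Ks p q) (+-monoʳ-≤ (count (λ K → hasVertex K p) Ks)
                          (m≤n+m (count (λ K → hasVertex K q) Ks) (if inq then 1 else 0))))
  ... | false | true  = ≤-trans (s≤s (defined-signature Ks p q)) (≤-reflexive (sym (+-suc _ _)))
  ... | false | false = defined-signature Ks p q

  signature-conflict : ∀ {Ks K p q p′ q′ a b} → K ∈ Ks →
    label p q K ≡ just a → label p′ q′ K ≡ just b → a ≢ b → Conflict (signature Ks p q) (signature Ks p′ q′)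
  signature-conflict (here refl)   la lb a≢b rewrite la | lb = here a≢b
  signature-conflict (there K∈Ks)  la lb a≢b = there (signature-conflict K∈Ks la lb a≢b)

module Arcs (m : ℕ) where

  Arc : Set
  Arc = Fin (m * m)

  arc : Fin m → Fin m → Arc
  arc = combine {m} {m}

  source target : Arc → Fin m
  source v = proj₁ (remQuot {m} m v)
  target   v = proj₂ (remQuot {m} m v)

  source-arc : ∀ a b → source (arc a b) ≡ a
  source-arc a b = cong proj₁ (remQuot-combine a b)

  target-arc : ∀ a b → target (arc a b) ≡ b
  target-arc a b = cong proj₂ (remQuot-combine a b)

  arc-ext : ∀ {v a b} → source v ≡ a → target v ≡ b → v ≡ arc a b
  arc-ext {v} refl refl = sym (combine-remQuot {m} m v)

  Adjacent : Arc → Arc → Set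
  Adjacent u v = source u ≢ target u × source v ≢ target v × (target u ≡ source v ⊎ target v ≡ source u)

  adjacent? : ∀ u v → Dec (Adjacent u v)
  adjacent? u v = ¬? (source u ≟ᶠ target u) ×-dec ¬? (source v ≟ᶠ target v)
                  ×-dec (target u ≟ᶠ source v ⊎-dec target v ≟ᶠ source u)

  Adjacent-sym : ∀ {u v} → Adjacent u v → Adjacent v u
  Adjacent-sym (u-loopless , v-loopless , meet) = v-loopless , u-loopless , swap meet

  Adjacent-irrefl : ∀ {v} → ¬ Adjacent v v
  Adjacent-irrefl (loopless , _ , inj₁ e) = loopless (sym e)
  Adjacent-irrefl (loopless , _ , inj₂ e) = loopless (sym e)

  sameTarget⇒¬Adjacent : ∀ {u v} → target u ≡ target v → ¬ Adjacent u v
  sameTarget⇒¬Adjacent eq (_ , v-loopless , inj₁ e) = v-loopless (trans (sym e) eq)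
  sameTarget⇒¬Adjacent eq (u-loopless , _ , inj₂ e) = u-loopless (trans (sym e) (sym eq))

  -- The loops a → a are isolated vertices.
  graph : Graph
  graph = record
    { n      = m * m
    ; adj    = λ u v → does (adjacent? u v)
    ; sym    = λ u v → does-⇔ (mk⇔ Adjacent-sym Adjacent-sym) (adjacent? u v) (adjacent? v u)
    ; irrefl = λ v → dec-false (adjacent? v v) Adjacent-irrefl
    }

  adj⇒Adjacent : ∀ {u v} → adj graph u v ≡ true → Adjacent u v
  adj⇒Adjacent {u} {v} = does≡true⇒ (adjacent? u v)

  arc-injectiveˡ : ∀ {a b a′ b′} → arc a b ≡ arc a′ b′ → a ≡ a′
  arc-injectiveˡ {a} {b} {a′} {b′} e = trans (sym (source-arc a b)) (trans (cong source e) (source-arc a′ b′))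

  consecutive-adj : ∀ {a b d} → a ≢ b → b ≢ d → adj graph (arc a b) (arc b d) ≡ true
  consecutive-adj {a} {b} {d} a≢b b≢d = dec-true (adjacent? (arc a b) (arc b d))
    ( (λ e → a≢b (trans (sym (source-arc a b)) (trans e (target-arc a b))))
    , (λ e → b≢d (trans (sym (source-arc b d)) (trans e (target-arc b d))))
    , inj₁ (trans (target-arc a b) (sym (source-arc b d))) )

  Lonely : Biclique graph → Arc → Set
  Lonely K p = ∀ v → hasVertex K v ≡ true → target v ≡ target p → v ≡ p

  lonely? : ∀ K p → Dec (Lonely K p)
  lonely? K p = Finₚ.all? λ v → (hasVertex K v ≟ᵇ true) →-dec (target v ≟ᶠ target p) →-dec (v ≟ᶠ p)

  crowded⇒reverse-lonely : ∀ {K i c v} → hasEdge K (arc i c) (arc c i) ≡ true →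
    hasVertex K v ≡ true → target v ≡ c → v ≢ arc i c → Lonely K (arc c i)
  crowded⇒reverse-lonely {K} {i} {c} {v} e hv ev v≢p w hw ew =
    endpoints (adj⇒Adjacent (sides≢⇒adj K hv hw v≁w))
    where
    v∼p : A K v ≡ A K (arc i c)
    v∼p = nonadjacent⇒sameSide K hv (edge⇒vertexˡ K e)
            (sameTarget⇒¬Adjacent (trans ev (sym (target-arc i c))) ∘ adj⇒Adjacent)
    w∼q : A K w ≡ A K (arc c i)
    w∼q = nonadjacent⇒sameSide K hw (edge⇒vertexʳ K e) (sameTarget⇒¬Adjacent ew ∘ adj⇒Adjacent)
    v≁w : A K v ≢ A K w
    v≁w v∼w = edge⇒sides≢ K e (trans (sym v∼p) (trans v∼w w∼q))
    endpoints : Adjacent v w → w ≡ arc c i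
    endpoints (_ , _ , inj₁ ev≡sw) = arc-ext (trans (sym ev≡sw) ev) (trans ew (target-arc c i))
    endpoints (_ , _ , inj₂ ew≡sv) =
      contradiction (arc-ext (trans (sym ew≡sv) (trans ew (target-arc c i))) ev) v≢p

  module LowerBound (Ks : List (Biclique graph)) (partition : IsPartition graph Ks)
                    (r : ℕ) (local : IsLocal graph r Ks) where

    block : ∀ {u v} → adj graph u v ≡ true → ∃ λ K → K ∈ Ks × hasEdge K u v ≡ true
    block {u} {v} e = count≥1⇒∈ (λ K → hasEdge K u v) Ks (≤-reflexive (sym (partition u v e)))

    block-unique : ∀ {u v K K′} → adj graph u v ≡ true → K ∈ Ks → K′ ∈ Ks →
      hasEdge K u v ≡ true → hasEdge K′ u v ≡ true → K ≡ K′
    block-unique {u} {v} e = count≡1⇒unique (λ K → hasEdge K u v) (partition u v e)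

    Private : Fin m → Fin m → Set
    Private c i = All (λ K → hasEdge K (arc i c) (arc c i) ≡ true → Lonely K (arc i c)) Ks

    private? : ∀ c i → Dec (Private c i)
    private? c i = All.all? (λ K → (hasEdge K (arc i c) (arc c i) ≟ᵇ true) →-dec lonely? K (arc i c)) Ks

    lonelyBlock⇒Private : ∀ {c i K₀} → K₀ ∈ Ks → hasEdge K₀ (arc i c) (arc c i) ≡ true →
      Lonely K₀ (arc i c) → Private c i
    lonelyBlock⇒Private {c} {i} {K₀} K₀∈Ks e₀ lonely = All.tabulate λ {K} K∈Ks e →
      subst (λ K → Lonely K (arc i c)) (block-unique (edge⇒adj K₀ e₀) K₀∈Ks K∈Ks e₀ e) lonely

    private-dichotomy : ∀ {c i} → i ≢ c → Private c i ⊎ Private i c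
    private-dichotomy {c} {i} i≢c with block (consecutive-adj i≢c (i≢c ∘ sym))
    ... | K₀ , K₀∈Ks , e₀ with Finₚ.any? (λ v → (hasVertex K₀ v ≟ᵇ true) ×-dec (target v ≟ᶠ c) ×-dec ¬? (v ≟ᶠ arc i c))
    ... | yes (v , hv , ev , v≢p) =
      inj₂ (lonelyBlock⇒Private K₀∈Ks (trans (hasEdge-sym K₀ (arc c i) (arc i c)) e₀)
                                        (crowded⇒reverse-lonely {K₀} e₀ hv ev v≢p))
    ... | no uncrowded = inj₁ (lonelyBlock⇒Private K₀∈Ks e₀ λ v hv ev →
      decidable-stable (v ≟ᶠ arc i c) λ v≢p → uncrowded (v , hv , trans ev (target-arc i c) , v≢p))

    cycleSignature : Fin m → Fin m → Word (length Ks)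
    cycleSignature c i = signature Ks (arc i c) (arc c i)

    -- The block of the edge (j → c, c → i) contains j → c, so it cannot be the block of i ⇄ c.
    private-conflict : ∀ {c i j} → i ≢ j → i ≢ c → j ≢ c → Private c i →
      Conflict (cycleSignature c i) (cycleSignature c j)
    private-conflict {c} {i} {j} i≢j i≢c j≢c priv
      with block (consecutive-adj j≢c (i≢c ∘ sym))
    ... | K , K∈Ks , e =
      signature-conflict K∈Ks (label-nonEdge K (arc i c) (arc c i) (edge⇒vertexʳ K e) ¬iEdge)
                              (label-vertex K (arc j c) (arc c j) (edge⇒vertexˡ K e)) (edge⇒sides≢ K e ∘ sym)
      where
      ¬iEdge : hasEdge K (arc i c) (arc c i) ≡ false
      ¬iEdge = ¬-not λ iEdge → i≢j (sym (arc-injectiveˡ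
        (All.lookup priv K∈Ks iEdge (arc j c) (edge⇒vertexˡ K e) (trans (target-arc j c) (sym (target-arc i c))))))

    Owns : Fin m → Fin m → Set
    Owns c i = Private c i × i ≢ c

    owns? : ∀ c i → Dec (Owns c i)
    owns? c i = private? c i ×-dec ¬? (i ≟ᶠ c)

    owned≤4^r : ∀ c → ∑[ i < m ] 𝟙 (owns? c i) ≤ 4 ^ r
    owned≤4^r c = subst (∑[ i < m ] 𝟙 (owns? c i) ≤_) (sym (^-*-assoc 2 2 r))
      (conflicting-words≤2^d (owns? c) (cycleSignature c) conflicting sparse)
      where
      conflicting : PairwiseConflicting (Owns c) (cycleSignature c)
      conflicting i j i≢j (priv , i≢c) (_ , j≢c) = private-conflict i≢j i≢c j≢c priv
      sparse : ∀ i → Owns c i → defined (cycleSignature c i) ≤ 2 * r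
      sparse i _ = begin
        defined (cycleSignature c i)
          ≤⟨ defined-signature Ks (arc i c) (arc c i) ⟩
        count (λ K → hasVertex K (arc i c)) Ks + count (λ K → hasVertex K (arc c i)) Ks
          ≤⟨ +-mono-≤ (local (arc i c)) (local (arc c i)) ⟩
        r + r
          ≡⟨ cong (r +_) (+-identityʳ r) ⟨
        2 * r ∎
        where open ≤-Reasoning

    m∸1≤3*4^r : m ∸ 1 ≤ 3 * 4 ^ r
    m∸1≤3*4^r = ≤-trans (semicomplete-order∸1≤2*outdegree owns? semicomplete owned≤4^r)
                        (*-monoˡ-≤ (4 ^ r) (n≤1+n 2))
      where
      semicomplete : ∀ c i → i ≢ c → Owns c i ⊎ Owns i c
      semicomplete c i i≢c = Sum.map (_, i≢c) (_, i≢c ∘ sym) (private-dichotomy i≢c)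

module StarCover (k : ℕ) where

  open Arcs (suc (suc k))

  another : (c : Fin (suc (suc k))) → ∃ λ d → d ≢ c
  another zero    = suc zero , λ ()
  another (suc _) = zero , λ ()

  Into Out : Fin (suc (suc k)) → Arc → Set
  Into c v = target v ≡ c × source v ≢ c
  Out  c v = source v ≡ c × target v ≢ c

  into? : ∀ c v → Dec (Into c v)
  into? c v = (target v ≟ᶠ c) ×-dec ¬? (source v ≟ᶠ c)

  out? : ∀ c v → Dec (Out c v)
  out? c v = (source v ≟ᶠ c) ×-dec ¬? (target v ≟ᶠ c)

  star : Fin (suc (suc k)) → Biclique graph
  star c = record
    { A          = λ v → does (into? c v)
    ; B          = λ v → does (out? c v)
    ; A-nonempty = let d , d≢c = another c in
                   arc d c , dec-true (into? c (arc d c)) (target-arc d c , d≢c ∘ trans (sym (source-arc d c)))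
    ; B-nonempty = let d , d≢c = another c in
                   arc c d , dec-true (out? c (arc c d)) (source-arc c d , d≢c ∘ trans (sym (target-arc c d)))
    ; disjoint   = into-out-disjoint
    ; complete   = λ a b Aa Bb →
                   into-out-adjacent {a} {b} (does≡true⇒ (into? c a) Aa) (does≡true⇒ (out? c b) Bb)
    }
    where
    into-out-disjoint : ∀ v → does (into? c v) ∧ does (out? c v) ≡ false
    into-out-disjoint v = dec-false (into? c v ×-dec out? c v) λ ((ev , _) , (_ , ¬ev)) → ¬ev ev
    into-out-adjacent : ∀ {a b} → Into c a → Out c b → adj graph a b ≡ true
    into-out-adjacent {a} {b} (ea , sa≢c) (sb , eb≢c) = dec-true (adjacent? a b)
      ( (λ sa≡ea → sa≢c (trans sa≡ea ea))
      , (λ sb≡eb → eb≢c (trans (sym sb≡eb) sb))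
      , inj₁ (trans ea (sym sb)) )

  stars : List (Biclique graph)
  stars = tabulate star

  star-edge : ∀ u v → Adjacent u v → target u ≡ source v → hasEdge (star (target u)) u v ≡ true
  star-edge u v (u-loopless , v-loopless , _) tu≡sv
    rewrite dec-true (into? (target u) u) (refl , u-loopless)
          | dec-true (out? (target u) v) (sym tu≡sv , λ tv≡tu → v-loopless (trans (sym tu≡sv) (sym tv≡tu))) = refl

  stars-cover : IsCover graph stars
  stars-cover u v e with adj⇒Adjacent {u} {v} e
  ... | uv@(_ , _ , inj₁ tu≡sv) = ∈⇒count≥1 (λ K → hasEdge K u v) (∈-tabulate⁺ {f = star} (target u))
    (star-edge u v uv tu≡sv)
  ... | uv@(_ , _ , inj₂ tv≡su) = ∈⇒count≥1 (λ K → hasEdge K u v) (∈-tabulate⁺ {f = star} (target v))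
    (trans (hasEdge-sym (star (target v)) u v) (star-edge v u (Adjacent-sym {u} {v} uv) tv≡su))

  stars-local : IsLocal graph 2 stars
  stars-local v = begin
    count (λ K → hasVertex K v) stars
      ≡⟨ count-tabulate (λ K → hasVertex K v) star ⟩
    ∑[ c < suc (suc k) ] 𝟙 (T? (hasVertex (star c) v))
      ≤⟨ sum-mono-≤ _ _ (λ c → 𝟙-⊎ (T? (hasVertex (star c) v)) (c ≟ᶠ target v) (c ≟ᶠ source v) (centre c)) ⟩
    ∑[ c < suc (suc k) ] (𝟙 (c ≟ᶠ target v) + 𝟙 (c ≟ᶠ source v))
      ≡⟨ ∑-distrib-+ (λ c → 𝟙 (c ≟ᶠ target v)) (λ c → 𝟙 (c ≟ᶠ source v)) ⟩
    ∑[ c < suc (suc k) ] 𝟙 (c ≟ᶠ target v) + ∑[ c < suc (suc k) ] 𝟙 (c ≟ᶠ source v)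
      ≤⟨ +-mono-≤ (at-most-one (target v)) (at-most-one (source v)) ⟩
    2 ∎
    where
    open ≤-Reasoning
    at-most-one : ∀ a → ∑[ c < suc (suc k) ] 𝟙 (c ≟ᶠ a) ≤ 1
    at-most-one a = sum-𝟙≤1 (_≟ᶠ a) λ _ _ c≡a d≡a → trans c≡a (sym d≡a)
    centre : ∀ c → T (hasVertex (star c) v) → c ≡ target v ⊎ c ≡ source v
    centre c hv = Sum.map (sym ∘ proj₁) (sym ∘ proj₁)
      (does≡true⇒ (into? c v ⊎-dec out? c v) (Equivalence.to T-≡ hv))

  hasStarCover : HasLocalMCover 2 (suc (suc k)) graph
  hasStarCover = stars , stars-cover , ≤-reflexive (length-tabulate star) , stars-local

mainTheorem6 : (m : ℕ) → 2 ≤ m →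
    Σ Graph (λ G → HasLocalMCover 2 m G × LbpAtLeastHalfLog G m)
mainTheorem6 (suc (suc k)) (s≤s (s≤s _)) =
  graph , hasStarCover , λ r (Ks , partition , local) → LowerBound.m∸1≤3*4^r Ks partition r local
  where
  open Arcs (suc (suc k))
  open StarCover k
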